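{- Let $m\geq 2$ be an integer with binary representation $m=2^{k_r}+\cdots+2^{k_1}$, $k_r>\cdots>k_1\geq 0$, and let $f_{m,n}(z)=\sum_{j=0}^{n}\binom{n}{j}z^{\binom{j}{m}}$. Define $g_0(x)=x-2$ and $g_k(x)=(x-1)^{2^k}+1$ for $k\geq 1$. Let $p_m(x)$ denote the characteristic polynomial of the sequence $(f_{m,n}(-1))_{n\geq 1}$. Then: (1) if $m=2^k$, then $p_m(x)=g_k(x)$; (2) if $m$ is even and not a power of $2$, then $p_m(x)=g_{k_r}(x)\cdots g_{k_1}(x)\,g_0(x)$; (3) if $m$ is odd, then $p_m(x)=g_{k_r}(x)\cdots g_{k_1}(x)$.
   Context: Here $\binom{j}{m}=0$ for $0\le j<m$. A monic polynomial $p(x)=x^d+c_{d-1}x^{d-1}+\cdots+c_0$ is the characteristic polynomial of a sequence $(a_n)_{n\geq 1}$ in the sense that the sequence satisfies the linear recurrence $a_{n+d}+c_{d-1}a_{n+d-1}+\cdots+c_0a_n=0$ for all $n\geq 1$. -}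

module Defs where

open import Data.Nat as ℕ using (ℕ; zero; suc)
open import Data.Nat.Combinatorics using (_C_)
open import Data.Integer as ℤ using (ℤ; +_; -_; _+_; _*_; _^_)
open import Data.List using (List; []; _∷_; map; foldr; _∷ʳ_)
open import Data.Product using (∃; _×_)
open import Relation.Binary.PropositionalEquality using (_≡_)

sumTo : ℕ → (ℕ → ℤ) → ℤ
sumTo zero    F = F 0
sumTo (suc n) F = sumTo n F + F (suc n)

f : ℕ → ℕ → ℤ → ℤ
f m n z = sumTo n (λ j → + (n C j) * (z ^ (j C m)))

a : ℕ → ℕ → ℤ
a m n = f m n (- + 1)

-- Polynomials over ℤ as coefficient lists, lowest degree first.
Poly : Set
Poly = List ℤ

infixl 6 _+ₚ_
infixl 7 _*ₚ_

_+ₚ_ : Poly → Poly → Poly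
[]      +ₚ q       = q
(x ∷ p) +ₚ []      = x ∷ p
(x ∷ p) +ₚ (y ∷ q) = (x + y) ∷ (p +ₚ q)

scale : ℤ → Poly → Poly
scale c = map (c *_)

_*ₚ_ : Poly → Poly → Poly
[]      *ₚ q = []
(x ∷ p) *ₚ q = scale x q +ₚ (+ 0 ∷ (p *ₚ q))

oneₚ : Poly
oneₚ = + 1 ∷ []

powₚ : Poly → ℕ → Poly
powₚ p zero    = oneₚ
powₚ p (suc n) = p *ₚ powₚ p n

g : ℕ → Poly
g zero    = - + 2 ∷ + 1 ∷ []
g (suc k) = powₚ (- + 1 ∷ + 1 ∷ []) (2 ℕ.^ suc k) +ₚ oneₚ

prodG : List ℕ → Poly
prodG = foldr (λ k acc → g k *ₚ acc) oneₚ

recSum : Poly → (ℕ → ℤ) → ℕ → ℤ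
recSum []      s n = + 0
recSum (c ∷ p) s n = c * s n + recSum p s (suc n)

Monic : Poly → Set
Monic p = ∃ λ cs → p ≡ cs ∷ʳ + 1

-- p(x) = x^d + c_{d-1}x^{d-1} + ⋯ + c_0 is the characteristic polynomial of (s_n)_{n≥1}
-- in the sense that s_{n+d} + c_{d-1} s_{n+d-1} + ⋯ + c_0 s_n = 0 for all n ≥ 1
IsCharPoly : Poly → (ℕ → ℤ) → Set
IsCharPoly p s = Monic p × (∀ n → 1 ℕ.≤ n → recSum p s n ≡ + 0)

-- Write a m n = Σ_j C(n,j) h_m(j) with h_m(j) = (-1)^C(j,m): the sequence is the binomial
-- transform of h_m.  Under this transform the polynomial (x-1)^N, acting as a recurrence
-- operator, becomes the shift h ↦ h(N + _), so g_k acts on h as h(2^k + j) ± h(j).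
-- Lucas' theorem modulo 2 gives, for m' < 2^k, that h_{2^k+m'}(2^k + j) + h_{2^k+m'}(j) =
-- 1 + h_{m'}(j); hence the factors g_{k_r}, …, g_{k_i} (k_i ≥ 1) strip the binary digits of m
-- one at a time up to an additive constant, leaving h_0 = -1 or h_1 = (-1)^j.  The
-- remaining factor x - 2 = g_0 acts as a difference, which kills the constant and turns
-- (-1)^j into -2(-1)^j, whose binomial transform vanishes for n ≥ 1.
module Submission where

open import Defs
open import Data.Nat using (ℕ; _≤_; _>_; _^_)
open import Data.Nat.Divisibility using (_∣_)
open import Data.List using (List; map)
open import Data.Nat.ListAction using (sum)
open import Data.List.Relation.Unary.Linked using (Linked)
open import Data.Product using (∃; _×_)
open import Relation.Nullary using (¬_)
open import Relation.Binary.PropositionalEquality using (_≡_)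

open import Data.Nat as ℕ using (zero; suc; _<_; z≤n; s≤s)
import Data.Nat.Properties as ℕP
open import Data.Nat.Combinatorics using (_C_; nCk+nC[k+1]≡[n+1]C[k+1]; k>n⇒nCk≡0; nC1≡n)
open import Data.Nat.Divisibility using (∣m+n∣m⇒∣n; ∣m∣n⇒∣m+n; m∣m*n; ∣⇒≤)
open import Data.Nat.ListAction.Properties using (sum-++)
open import Algebra.Properties.CommutativeSemigroup ℕP.+-commutativeSemigroup using (x∙yz≈y∙xz)
open import Data.Integer as ℤ using (ℤ; +_; -_; _+_; _*_)
import Data.Integer.Properties as ℤP
open import Data.Integer.Tactic.RingSolver using (solve-∀)
open import Data.List using ([]; _∷_; _∷ʳ_; length; foldr)
open import Data.List.Properties using (length-map; length-++; map-cong; map-id; map-++; foldr-∷ʳ)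
open import Data.List.Relation.Unary.Linked using ([-]; _∷_; tail)
open import Data.Product using (_,_)
open import Data.Sum using (_⊎_; inj₁; inj₂)
open import Data.Empty using (⊥-elim)
open import Function using (_∘_)
open import Relation.Binary.PropositionalEquality
  using (refl; sym; trans; cong; cong₂; subst; module ≡-Reasoning)

open ≡-Reasoning

MonicOfDegree : ℕ → Poly → Set
MonicOfDegree d p = ∃ λ cs → length cs ≡ d × p ≡ cs ∷ʳ + 1

monicOfDegree⇒monic : ∀ {d p} → MonicOfDegree d p → Monic p
monicOfDegree⇒monic (cs , _ , eq) = cs , eq

+ₚ-[] : ∀ p → p +ₚ [] ≡ p
+ₚ-[] []      = refl
+ₚ-[] (x ∷ p) = refl

∷ʳ-+ₚ-[0] : ∀ cs x → (cs ∷ʳ x) +ₚ (+ 0 ∷ []) ≡ cs ∷ʳ x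
∷ʳ-+ₚ-[0] []       x = cong (_∷ []) (ℤP.+-identityʳ x)
∷ʳ-+ₚ-[0] (c ∷ cs) x = cong₂ _∷_ (ℤP.+-identityʳ c) (+ₚ-[] (cs ∷ʳ x))

+ₚ-comm : ∀ p q → p +ₚ q ≡ q +ₚ p
+ₚ-comm []      []      = refl
+ₚ-comm []      (y ∷ q) = refl
+ₚ-comm (x ∷ p) []      = refl
+ₚ-comm (x ∷ p) (y ∷ q) = cong₂ _∷_ (ℤP.+-comm x y) (+ₚ-comm p q)

scale-1 : ∀ p → scale (+ 1) p ≡ p
scale-1 p = trans (map-cong ℤP.*-identityˡ p) (map-id p)

+ₚ-∷ʳ : ∀ p cs x → length p ≤ length cs →
        ∃ λ cs′ → length cs′ ≡ length cs × p +ₚ (cs ∷ʳ x) ≡ cs′ ∷ʳ x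
+ₚ-∷ʳ []      cs       x _         = cs , refl , refl
+ₚ-∷ʳ (y ∷ p) (c ∷ cs) x (s≤s len) with +ₚ-∷ʳ p cs x len
... | cs′ , len′ , eq = (y + c) ∷ cs′ , cong suc len′ , cong ((y + c) ∷_) eq

+ₚ-monicOfDegree : ∀ {d p q} → length p ≤ d → MonicOfDegree d q → MonicOfDegree d (p +ₚ q)
+ₚ-monicOfDegree {p = p} len (cs , refl , refl) with +ₚ-∷ʳ p cs (+ 1) len
... | cs′ , len′ , eq = cs′ , len′ , eq

*ₚ-monicOfDegree : ∀ {d e p q} → MonicOfDegree d p → MonicOfDegree e q →
                   MonicOfDegree (d ℕ.+ e) (p *ₚ q)
*ₚ-monicOfDegree ([] , refl , refl) (ds , refl , refl) =
  ds , refl , trans (cong (_+ₚ (+ 0 ∷ [])) (scale-1 (ds ∷ʳ + 1))) (∷ʳ-+ₚ-[0] ds (+ 1))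
*ₚ-monicOfDegree (c ∷ cs , refl , refl) q@(ds , refl , refl)
  with *ₚ-monicOfDegree (cs , refl , refl) q
... | es , len , eq = +ₚ-monicOfDegree scale≤ (+ 0 ∷ es , cong suc len , cong (+ 0 ∷_) eq)
  where
  scale≤ : length (scale c (ds ∷ʳ + 1)) ≤ suc (length cs ℕ.+ length ds)
  scale≤ = subst (_≤ suc (length cs ℕ.+ length ds))
                 (sym (trans (length-map (c *_) (ds ∷ʳ + 1)) (trans (length-++ ds) (ℕP.+-comm (length ds) 1))))
                 (s≤s (ℕP.m≤n+m (length ds) (length cs)))

*ₚ-monic : ∀ {p q} → Monic p → Monic q → Monic (p *ₚ q)
*ₚ-monic (cs , eq) (ds , eq′) = monicOfDegree⇒monic (*ₚ-monicOfDegree (cs , refl , eq) (ds , refl , eq′))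

powₚ-monicOfDegree : ∀ {d p} → MonicOfDegree d p → ∀ N → MonicOfDegree (N ℕ.* d) (powₚ p N)
powₚ-monicOfDegree mp zero    = [] , refl , refl
powₚ-monicOfDegree mp (suc N) = *ₚ-monicOfDegree mp (powₚ-monicOfDegree mp N)

xMinusOne : Poly
xMinusOne = - + 1 ∷ + 1 ∷ []

g-monic : ∀ k → Monic (g k)
g-monic zero    = - + 2 ∷ [] , refl
g-monic (suc k) = monicOfDegree⇒monic (subst (MonicOfDegree (N ℕ.* 1)) (+ₚ-comm oneₚ (powₚ xMinusOne N))
  (+ₚ-monicOfDegree (subst (1 ≤_) (sym (ℕP.*-identityʳ N)) (ℕP.m^n>0 2 (suc k)))
                    (powₚ-monicOfDegree (- + 1 ∷ [] , refl , refl) N)))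
  where
  N : ℕ
  N = 2 ^ suc k

prodG-monic : ∀ ks → Monic (prodG ks)
prodG-monic []       = [] , refl
prodG-monic (k ∷ ks) = *ₚ-monic (g-monic k) (prodG-monic ks)

-- Binomial transform

binomialTransform : (ℕ → ℤ) → ℕ → ℤ
binomialTransform h n = sumTo n (λ j → + (n C j) * h j)

sumTo-cong : ∀ n {F G : ℕ → ℤ} → (∀ j → F j ≡ G j) → sumTo n F ≡ sumTo n G
sumTo-cong zero    F≗G = F≗G 0
sumTo-cong (suc n) F≗G = cong₂ _+_ (sumTo-cong n F≗G) (F≗G (suc n))

sumTo-distrib-+ : ∀ n (F G : ℕ → ℤ) → sumTo n (λ j → F j + G j) ≡ sumTo n F + sumTo n G
sumTo-distrib-+ zero    F G = refl
sumTo-distrib-+ (suc n) F G = trans (cong (_+ (F (suc n) + G (suc n))) (sumTo-distrib-+ n F G))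
                                    (+-interchange (sumTo n F) (sumTo n G) (F (suc n)) (G (suc n)))
  where
  +-interchange : ∀ a b c d → a + b + (c + d) ≡ a + c + (b + d)
  +-interchange = solve-∀

*-distribˡ-sumTo : ∀ n c (F : ℕ → ℤ) → sumTo n (λ j → c * F j) ≡ c * sumTo n F
*-distribˡ-sumTo zero    c F = refl
*-distribˡ-sumTo (suc n) c F = trans (cong (_+ c * F (suc n)) (*-distribˡ-sumTo n c F))
                                     (sym (ℤP.*-distribˡ-+ c _ _))

sumTo-suc-head : ∀ n (F : ℕ → ℤ) → sumTo (suc n) F ≡ F 0 + sumTo n (F ∘ suc)
sumTo-suc-head zero    F = refl
sumTo-suc-head (suc n) F = trans (cong (_+ F (suc (suc n))) (sumTo-suc-head n F))
                                 (ℤP.+-assoc (F 0) (sumTo n (F ∘ suc)) (F (suc (suc n))))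

binomialTransform-cong : ∀ {h h′ : ℕ → ℤ} → (∀ j → h j ≡ h′ j) →
                         ∀ n → binomialTransform h n ≡ binomialTransform h′ n
binomialTransform-cong h≗h′ n = sumTo-cong n (λ j → cong (+ (n C j) *_) (h≗h′ j))

binomialTransform-distrib-+ : ∀ (h h′ : ℕ → ℤ) n →
  binomialTransform (λ j → h j + h′ j) n ≡ binomialTransform h n + binomialTransform h′ n
binomialTransform-distrib-+ h h′ n =
  trans (sumTo-cong n (λ j → ℤP.*-distribˡ-+ (+ (n C j)) (h j) (h′ j))) (sumTo-distrib-+ n _ _)

*-distribˡ-binomialTransform : ∀ c (h : ℕ → ℤ) n →
  binomialTransform (λ j → c * h j) n ≡ c * binomialTransform h n
*-distribˡ-binomialTransform c h n =
  trans (sumTo-cong n (λ j → x*[y*z]≡y*[x*z] (+ (n C j)) c (h j))) (*-distribˡ-sumTo n c _)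
  where
  x*[y*z]≡y*[x*z] : ∀ x y z → x * (y * z) ≡ y * (x * z)
  x*[y*z]≡y*[x*z] = solve-∀

binomialTransform-zero : ∀ n → binomialTransform (λ _ → + 0) n ≡ + 0
binomialTransform-zero n = *-distribˡ-binomialTransform (+ 0) (λ _ → + 0) n

-- The extra term C(n, n+1) h(n+1) of the longer sum is zero.
binomialTransform-unshift : ∀ (h : ℕ → ℤ) n →
  + 1 * h 0 + sumTo n (λ j → + (n C suc j) * h (suc j)) ≡ binomialTransform h n
binomialTransform-unshift h n = begin
  + 1 * h 0 + sumTo n (λ j → + (n C suc j) * h (suc j))
    ≡⟨ sumTo-suc-head n _ ⟨
  sumTo (suc n) (λ j → + (n C j) * h j)
    ≡⟨ cong (λ c → binomialTransform h n + + c * h (suc n)) (k>n⇒nCk≡0 (ℕP.n<1+n n)) ⟩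
  binomialTransform h n + + 0
    ≡⟨ ℤP.+-identityʳ _ ⟩
  binomialTransform h n
    ∎

binomialTransform-suc : ∀ (h : ℕ → ℤ) n →
  binomialTransform h (suc n) ≡ binomialTransform h n + binomialTransform (h ∘ suc) n
binomialTransform-suc h n = begin
  binomialTransform h (suc n)
    ≡⟨ sumTo-suc-head n _ ⟩
  + 1 * h 0 + sumTo n (λ j → + (suc n C suc j) * h (suc j))
    ≡⟨ cong (_+_ (+ 1 * h 0)) (sumTo-cong n pascal) ⟩
  + 1 * h 0 + sumTo n (λ j → + (n C j) * h (suc j) + + (n C suc j) * h (suc j))
    ≡⟨ cong (_+_ (+ 1 * h 0)) (sumTo-distrib-+ n _ _) ⟩
  + 1 * h 0 + (binomialTransform (h ∘ suc) n + rest)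
    ≡⟨ x+[y+z]≡x+z+y (+ 1 * h 0) _ rest ⟩
  + 1 * h 0 + rest + binomialTransform (h ∘ suc) n
    ≡⟨ cong (_+ binomialTransform (h ∘ suc) n) (binomialTransform-unshift h n) ⟩
  binomialTransform h n + binomialTransform (h ∘ suc) n
    ∎
  where
  rest : ℤ
  rest = sumTo n (λ j → + (n C suc j) * h (suc j))
  pascal : ∀ j → + (suc n C suc j) * h (suc j) ≡ + (n C j) * h (suc j) + + (n C suc j) * h (suc j)
  pascal j = trans (cong (λ c → + c * h (suc j)) (sym (nCk+nC[k+1]≡[n+1]C[k+1] n j)))
                   (ℤP.*-distribʳ-+ (h (suc j)) (+ (n C j)) (+ (n C suc j)))
  x+[y+z]≡x+z+y : ∀ x y z → x + (y + z) ≡ x + z + y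
  x+[y+z]≡x+z+y = solve-∀

alt : ℕ → ℤ
alt n = (- + 1) ℤ.^ n

binomialTransform-alt : ∀ n → binomialTransform alt (suc n) ≡ + 0
binomialTransform-alt n = begin
  binomialTransform alt (suc n)                             ≡⟨ binomialTransform-suc alt n ⟩
  binomialTransform alt n + binomialTransform (λ j → - + 1 * alt j) n
    ≡⟨ cong (_+_ (binomialTransform alt n)) (*-distribˡ-binomialTransform (- + 1) alt n) ⟩
  binomialTransform alt n + - + 1 * binomialTransform alt n ≡⟨ x+-1*x≡0 (binomialTransform alt n) ⟩
  + 0                                                       ∎
  where
  x+-1*x≡0 : ∀ x → x + - + 1 * x ≡ + 0
  x+-1*x≡0 = solve-∀

-- Polynomials acting as recurrence operators

recSum-cong : ∀ p {s t : ℕ → ℤ} → (∀ i → s i ≡ t i) → ∀ n → recSum p s n ≡ recSum p t n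
recSum-cong []      s≗t n = refl
recSum-cong (c ∷ p) s≗t n = cong₂ (λ u v → c * u + v) (s≗t n) (recSum-cong p s≗t (suc n))

recSum-+ₚ : ∀ p q (s : ℕ → ℤ) n → recSum (p +ₚ q) s n ≡ recSum p s n + recSum q s n
recSum-+ₚ []      q       s n = sym (ℤP.+-identityˡ _)
recSum-+ₚ (x ∷ p) []      s n = sym (ℤP.+-identityʳ _)
recSum-+ₚ (x ∷ p) (y ∷ q) s n =
  trans (cong (_+_ ((x + y) * s n)) (recSum-+ₚ p q s (suc n)))
        (distrib x y (s n) (recSum p s (suc n)) (recSum q s (suc n)))
  where
  distrib : ∀ x y z u v → (x + y) * z + (u + v) ≡ (x * z + u) + (y * z + v)
  distrib = solve-∀

recSum-scale : ∀ c q (s : ℕ → ℤ) n → recSum (scale c q) s n ≡ c * recSum q s n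
recSum-scale c []      s n = sym (ℤP.*-zeroʳ c)
recSum-scale c (x ∷ q) s n =
  trans (cong (_+_ (c * x * s n)) (recSum-scale c q s (suc n))) (distrib c x (s n) (recSum q s (suc n)))
  where
  distrib : ∀ c x z u → c * x * z + c * u ≡ c * (x * z + u)
  distrib = solve-∀

recSum-*ₚ : ∀ p q (s : ℕ → ℤ) n → recSum (p *ₚ q) s n ≡ recSum p (recSum q s) n
recSum-*ₚ []      q s n = refl
recSum-*ₚ (x ∷ p) q s n = begin
  recSum (scale x q +ₚ (+ 0 ∷ (p *ₚ q))) s n
    ≡⟨ recSum-+ₚ (scale x q) _ s n ⟩
  recSum (scale x q) s n + (+ 0 * s n + recSum (p *ₚ q) s (suc n))
    ≡⟨ cong₂ (λ u v → u + (+ 0 * s n + v)) (recSum-scale x q s n) (recSum-*ₚ p q s (suc n)) ⟩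
  x * recSum q s n + (+ 0 + recSum p (recSum q s) (suc n))
    ≡⟨ cong (_+_ (x * recSum q s n)) (ℤP.+-identityˡ _) ⟩
  x * recSum q s n + recSum p (recSum q s) (suc n)
    ∎

recSum-oneₚ : ∀ (s : ℕ → ℤ) n → recSum oneₚ s n ≡ s n
recSum-oneₚ s n = trans (ℤP.+-identityʳ _) (ℤP.*-identityˡ _)

recSum-xMinusOne : ∀ h n → recSum xMinusOne (binomialTransform h) n ≡ binomialTransform (h ∘ suc) n
recSum-xMinusOne h n =
  trans (cong (λ v → - + 1 * binomialTransform h n + (+ 1 * v + + 0)) (binomialTransform-suc h n))
        (cancel (binomialTransform h n) (binomialTransform (h ∘ suc) n))
  where
  cancel : ∀ x y → - + 1 * x + (+ 1 * (x + y) + + 0) ≡ y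
  cancel = solve-∀

recSum-powₚ-xMinusOne : ∀ N h n →
  recSum (powₚ xMinusOne N) (binomialTransform h) n ≡ binomialTransform (λ j → h (N ℕ.+ j)) n
recSum-powₚ-xMinusOne zero    h n = recSum-oneₚ (binomialTransform h) n
recSum-powₚ-xMinusOne (suc N) h n = begin
  recSum (xMinusOne *ₚ powₚ xMinusOne N) (binomialTransform h) n
    ≡⟨ recSum-*ₚ xMinusOne (powₚ xMinusOne N) (binomialTransform h) n ⟩
  recSum xMinusOne (recSum (powₚ xMinusOne N) (binomialTransform h)) n
    ≡⟨ recSum-cong xMinusOne (recSum-powₚ-xMinusOne N h) n ⟩
  recSum xMinusOne (binomialTransform (λ j → h (N ℕ.+ j))) n
    ≡⟨ recSum-xMinusOne _ n ⟩
  binomialTransform (λ j → h (N ℕ.+ suc j)) n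
    ≡⟨ binomialTransform-cong (λ j → cong h (ℕP.+-suc N j)) n ⟩
  binomialTransform (λ j → h (suc N ℕ.+ j)) n
    ∎

gSign : ℕ → ℤ
gSign zero    = - + 1
gSign (suc k) = + 1

gOp : ℕ → (ℕ → ℤ) → ℕ → ℤ
gOp k h j = h (2 ^ k ℕ.+ j) + gSign k * h j

gsOp : List ℕ → (ℕ → ℤ) → ℕ → ℤ
gsOp ks h = foldr gOp h ks

binomialTransform-gOp : ∀ k h n →
  binomialTransform (gOp k h) n ≡ binomialTransform (λ j → h (2 ^ k ℕ.+ j)) n + gSign k * binomialTransform h n
binomialTransform-gOp k h n =
  trans (binomialTransform-distrib-+ (λ j → h (2 ^ k ℕ.+ j)) (λ j → gSign k * h j) n)
        (cong (_+_ (binomialTransform (λ j → h (2 ^ k ℕ.+ j)) n)) (*-distribˡ-binomialTransform (gSign k) h n))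

recSum-g : ∀ k h n → recSum (g k) (binomialTransform h) n ≡ binomialTransform (gOp k h) n
recSum-g zero h n = begin
  - + 2 * binomialTransform h n + (+ 1 * binomialTransform h (suc n) + + 0)
    ≡⟨ cong (λ v → - + 2 * binomialTransform h n + (+ 1 * v + + 0)) (binomialTransform-suc h n) ⟩
  - + 2 * binomialTransform h n + (+ 1 * (binomialTransform h n + binomialTransform (h ∘ suc) n) + + 0)
    ≡⟨ collect (binomialTransform h n) (binomialTransform (h ∘ suc) n) ⟩
  binomialTransform (h ∘ suc) n + - + 1 * binomialTransform h n
    ≡⟨ binomialTransform-gOp zero h n ⟨
  binomialTransform (gOp zero h) n
    ∎
  where
  collect : ∀ x y → - + 2 * x + (+ 1 * (x + y) + + 0) ≡ y + - + 1 * x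
  collect = solve-∀
recSum-g (suc k) h n = begin
  recSum (powₚ xMinusOne N +ₚ oneₚ) (binomialTransform h) n
    ≡⟨ recSum-+ₚ (powₚ xMinusOne N) oneₚ (binomialTransform h) n ⟩
  recSum (powₚ xMinusOne N) (binomialTransform h) n + recSum oneₚ (binomialTransform h) n
    ≡⟨ cong₂ _+_ (recSum-powₚ-xMinusOne N h n) (recSum-oneₚ (binomialTransform h) n) ⟩
  binomialTransform (λ j → h (N ℕ.+ j)) n + binomialTransform h n
    ≡⟨ cong (_+_ (binomialTransform (λ j → h (N ℕ.+ j)) n)) (ℤP.*-identityˡ _) ⟨
  binomialTransform (λ j → h (N ℕ.+ j)) n + + 1 * binomialTransform h n
    ≡⟨ binomialTransform-gOp (suc k) h n ⟨
  binomialTransform (gOp (suc k) h) n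
    ∎
  where
  N : ℕ
  N = 2 ^ suc k

recSum-prodG : ∀ ks h n → recSum (prodG ks) (binomialTransform h) n ≡ binomialTransform (gsOp ks h) n
recSum-prodG []       h n = recSum-oneₚ (binomialTransform h) n
recSum-prodG (k ∷ ks) h n = begin
  recSum (g k *ₚ prodG ks) (binomialTransform h) n
    ≡⟨ recSum-*ₚ (g k) (prodG ks) (binomialTransform h) n ⟩
  recSum (g k) (recSum (prodG ks) (binomialTransform h)) n
    ≡⟨ recSum-cong (g k) (recSum-prodG ks h) n ⟩
  recSum (g k) (binomialTransform (gsOp ks h)) n
    ≡⟨ recSum-g k (gsOp ks h) n ⟩
  binomialTransform (gsOp (k ∷ ks) h) n
    ∎

gOp-cong : ∀ k {h h′ : ℕ → ℤ} → (∀ j → h j ≡ h′ j) → ∀ j → gOp k h j ≡ gOp k h′ j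
gOp-cong k h≗h′ j = cong₂ (λ u v → u + gSign k * v) (h≗h′ (2 ^ k ℕ.+ j)) (h≗h′ j)

gOp-comm : ∀ k l (h : ℕ → ℤ) j → gOp k (gOp l h) j ≡ gOp l (gOp k h) j
gOp-comm k l h j =
  trans (cong (λ i → h i + gSign l * h (2 ^ k ℕ.+ j) + gSign k * (h (2 ^ l ℕ.+ j) + gSign l * h j))
              (x∙yz≈y∙xz (2 ^ l) (2 ^ k) j))
        (swap (h (2 ^ k ℕ.+ (2 ^ l ℕ.+ j))) (h (2 ^ k ℕ.+ j)) (h (2 ^ l ℕ.+ j)) (h j) (gSign k) (gSign l))
  where
  swap : ∀ w x y z p q → w + q * x + p * (y + q * z) ≡ w + p * y + q * (x + p * z)
  swap = solve-∀

gsOp-gOp-comm : ∀ ks k (h : ℕ → ℤ) j → gsOp ks (gOp k h) j ≡ gOp k (gsOp ks h) j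
gsOp-gOp-comm []       k h j = refl
gsOp-gOp-comm (l ∷ ks) k h j = trans (gOp-cong l (gsOp-gOp-comm ks k h) j) (gOp-comm l k (gsOp ks h) j)

infix 4 _≈ᶜ_

_≈ᶜ_ : (ℕ → ℤ) → (ℕ → ℤ) → Set
h ≈ᶜ h′ = ∃ λ c → ∀ j → h j ≡ c + h′ j

≈ᶜ-trans : ∀ {h h′ h″ : ℕ → ℤ} → h ≈ᶜ h′ → h′ ≈ᶜ h″ → h ≈ᶜ h″
≈ᶜ-trans {h″ = h″} (c , eq) (c′ , eq′) =
  c + c′ , λ j → trans (trans (eq j) (cong (_+_ c) (eq′ j))) (sym (ℤP.+-assoc c c′ (h″ j)))

≗-≈ᶜ-trans : ∀ {h h′ h″ : ℕ → ℤ} → (∀ j → h j ≡ h′ j) → h′ ≈ᶜ h″ → h ≈ᶜ h″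
≗-≈ᶜ-trans h≗h′ (c , eq) = c , λ j → trans (h≗h′ j) (eq j)

gOp-resp-≈ᶜ : ∀ k {h h′ : ℕ → ℤ} → h ≈ᶜ h′ → gOp k h ≈ᶜ gOp k h′
gOp-resp-≈ᶜ k {h′ = h′} (c , eq) = c + gSign k * c , λ j →
  trans (cong₂ (λ u v → u + gSign k * v) (eq (2 ^ k ℕ.+ j)) (eq j))
        (regroup c (h′ (2 ^ k ℕ.+ j)) (h′ j) (gSign k))
  where
  regroup : ∀ c x y e → c + x + e * (c + y) ≡ c + e * c + (x + e * y)
  regroup = solve-∀

gsOp-resp-≈ᶜ : ∀ ks {h h′ : ℕ → ℤ} → h ≈ᶜ h′ → gsOp ks h ≈ᶜ gsOp ks h′
gsOp-resp-≈ᶜ []       h≈h′ = h≈h′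
gsOp-resp-≈ᶜ (k ∷ ks) h≈h′ = gOp-resp-≈ᶜ k (gsOp-resp-≈ᶜ ks h≈h′)

gOp-zero-≈ᶜ : ∀ {h h′ : ℕ → ℤ} → h ≈ᶜ h′ → ∀ j → gOp 0 h j ≡ gOp 0 h′ j
gOp-zero-≈ᶜ {h′ = h′} (c , eq) j =
  trans (cong₂ (λ u v → u + - + 1 * v) (eq (suc j)) (eq j)) (cancel c (h′ (suc j)) (h′ j))
  where
  cancel : ∀ c x y → c + x + - + 1 * (c + y) ≡ x + - + 1 * y
  cancel = solve-∀

-- Binomial coefficients modulo 2

alt-+ : ∀ a b → alt (a ℕ.+ b) ≡ alt a * alt b
alt-+ = ℤP.^-distribˡ-+-* (- + 1)

alt-*-self : ∀ n → alt n * alt n ≡ + 1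
alt-*-self zero    = refl
alt-*-self (suc n) = trans (signs (alt n)) (alt-*-self n)
  where
  signs : ∀ x → - + 1 * x * (- + 1 * x) ≡ x * x
  signs = solve-∀

alt-2+ : ∀ n → alt (suc (suc n)) ≡ alt n
alt-2+ n = signs (alt n)
  where
  signs : ∀ x → - + 1 * (- + 1 * x) ≡ x
  signs = solve-∀

alt[1+nC1+k]≡alt[nCk]*alt[nC1+k] : ∀ n k → alt (suc n C suc k) ≡ alt (n C k) * alt (n C suc k)
alt[1+nC1+k]≡alt[nCk]*alt[nC1+k] n k =
  trans (cong alt (sym (nCk+nC[k+1]≡[n+1]C[k+1] n k))) (alt-+ (n C k) (n C suc k))

-- Applying Pascal's rule twice counts the middle term C(n, k+1) twice.
alt[2+nC2+k]≡alt[nC2+k]*alt[nCk] : ∀ n k →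
  alt (suc (suc n) C suc (suc k)) ≡ alt (n C suc (suc k)) * alt (n C k)
alt[2+nC2+k]≡alt[nC2+k]*alt[nCk] n k = begin
  alt (suc (suc n) C suc (suc k))
    ≡⟨ alt[1+nC1+k]≡alt[nCk]*alt[nC1+k] (suc n) (suc k) ⟩
  alt (suc n C suc k) * alt (suc n C suc (suc k))
    ≡⟨ cong₂ _*_ (alt[1+nC1+k]≡alt[nCk]*alt[nC1+k] n k) (alt[1+nC1+k]≡alt[nCk]*alt[nC1+k] n (suc k)) ⟩
  (alt (n C k) * alt (n C suc k)) * (alt (n C suc k) * alt (n C suc (suc k)))
    ≡⟨ regroup (alt (n C k)) (alt (n C suc k)) (alt (n C suc (suc k))) ⟩
  alt (n C suc (suc k)) * alt (n C k) * (alt (n C suc k) * alt (n C suc k))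
    ≡⟨ cong (_*_ (alt (n C suc (suc k)) * alt (n C k))) (alt-*-self (n C suc k)) ⟩
  alt (n C suc (suc k)) * alt (n C k) * + 1
    ≡⟨ ℤP.*-identityʳ _ ⟩
  alt (n C suc (suc k)) * alt (n C k)
    ∎
  where
  regroup : ∀ a b c → (a * b) * (b * c) ≡ c * a * (b * b)
  regroup = solve-∀

double : ℕ → ℕ
double zero    = zero
double (suc n) = suc (suc (double n))

double-+ : ∀ m n → double (m ℕ.+ n) ≡ double m ℕ.+ double n
double-+ zero    n = refl
double-+ (suc m) n = cong (suc ∘ suc) (double-+ m n)

double≡2* : ∀ n → double n ≡ 2 ℕ.* n
double≡2* zero    = refl
double≡2* (suc n) = trans (cong (suc ∘ suc) (double≡2* n)) (cong suc (sym (ℕP.+-suc n (n ℕ.+ 0))))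

double-cancel-< : ∀ {m n} → double m < double n → m < n
double-cancel-< {zero}  {suc n} _                 = s≤s z≤n
double-cancel-< {suc m} {suc n} (s≤s (s≤s 2m<2n)) = s≤s (double-cancel-< 2m<2n)

data Halving : ℕ → Set where
  even : ∀ q → Halving (double q)
  odd  : ∀ q → Halving (suc (double q))

halving : ∀ n → Halving n
halving zero = even zero
halving (suc n) with halving n
... | even q = odd q
... | odd q  = even (suc q)

alt[2nC1+2k]≡1 : ∀ n k → alt (double n C suc (double k)) ≡ + 1
alt[2nC1+2k]≡1 zero    k       = refl
alt[2nC1+2k]≡1 (suc n) zero    = begin
  alt (suc (suc (double n)) C 1) ≡⟨ cong alt (nC1≡n (suc (suc (double n)))) ⟩
  alt (suc (suc (double n)))     ≡⟨ alt-2+ (double n) ⟩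
  alt (double n)                 ≡⟨ cong alt (nC1≡n (double n)) ⟨
  alt (double n C 1)             ≡⟨ alt[2nC1+2k]≡1 n zero ⟩
  + 1                            ∎
alt[2nC1+2k]≡1 (suc n) (suc k) = trans (alt[2+nC2+k]≡alt[nC2+k]*alt[nCk] (double n) (suc (double k)))
                                       (cong₂ _*_ (alt[2nC1+2k]≡1 n (suc k)) (alt[2nC1+2k]≡1 n k))

alt[2nC2k]≡alt[nCk] : ∀ n k → alt (double n C double k) ≡ alt (n C k)
alt[2nC2k]≡alt[nCk] zero    zero    = refl
alt[2nC2k]≡alt[nCk] zero    (suc k) = refl
alt[2nC2k]≡alt[nCk] (suc n) zero    = refl
alt[2nC2k]≡alt[nCk] (suc n) (suc k) = begin
  alt (suc (suc (double n)) C suc (suc (double k)))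
    ≡⟨ alt[2+nC2+k]≡alt[nC2+k]*alt[nCk] (double n) (double k) ⟩
  alt (double n C double (suc k)) * alt (double n C double k)
    ≡⟨ cong₂ _*_ (alt[2nC2k]≡alt[nCk] n (suc k)) (alt[2nC2k]≡alt[nCk] n k) ⟩
  alt (n C suc k) * alt (n C k)
    ≡⟨ ℤP.*-comm (alt (n C suc k)) (alt (n C k)) ⟩
  alt (n C k) * alt (n C suc k)
    ≡⟨ alt[1+nC1+k]≡alt[nCk]*alt[nC1+k] n k ⟨
  alt (suc n C suc k)
    ∎

alt[1+2nC2k]≡alt[nCk] : ∀ n k → alt (suc (double n) C double k) ≡ alt (n C k)
alt[1+2nC2k]≡alt[nCk] n zero    = refl
alt[1+2nC2k]≡alt[nCk] n (suc k) =
  trans (alt[1+nC1+k]≡alt[nCk]*alt[nC1+k] (double n) (suc (double k)))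
        (trans (cong₂ _*_ (alt[2nC1+2k]≡1 n k) (alt[2nC2k]≡alt[nCk] n (suc k))) (ℤP.*-identityˡ _))

alt[1+2nC1+2k]≡alt[nCk] : ∀ n k → alt (suc (double n) C suc (double k)) ≡ alt (n C k)
alt[1+2nC1+2k]≡alt[nCk] n k =
  trans (alt[1+nC1+k]≡alt[nCk]*alt[nC1+k] (double n) (double k))
        (trans (cong₂ _*_ (alt[2nC2k]≡alt[nCk] n k) (alt[2nC1+2k]≡1 n k)) (ℤP.*-identityʳ _))

-- Definitionally, a m = binomialTransform (altBinom m).
altBinom : ℕ → ℕ → ℤ
altBinom m x = alt (x C m)

-- Modulo 2 this is C(N+x, N+m) = C(x, N+m) + C(x, m), the two terms on the right never both odd.
TopBitLaw : ℕ → Set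
TopBitLaw N = ∀ m x → m < N →
  altBinom (N ℕ.+ m) (N ℕ.+ x) + altBinom (N ℕ.+ m) x ≡ + 1 + altBinom m x

topBitLaw-1 : TopBitLaw 1
topBitLaw-1 zero x _ = begin
  alt (suc x C 1) + alt (x C 1) ≡⟨ cong₂ _+_ (cong alt (nC1≡n (suc x))) (cong alt (nC1≡n x)) ⟩
  - + 1 * alt x + alt x         ≡⟨ cancel (alt x) ⟩
  + 0                           ∎
  where
  cancel : ∀ a → - + 1 * a + a ≡ + 0
  cancel = solve-∀
topBitLaw-1 (suc m) x (s≤s ())

-- Lucas' theorem for the last binary digit transports the law from N to 2N.
topBitLaw-double-digits : ∀ {N} (r s : ℕ → ℕ) →
  (∀ u → double N ℕ.+ r u ≡ r (N ℕ.+ u)) → (∀ w → double N ℕ.+ s w ≡ s (N ℕ.+ w)) →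
  (∀ u w → alt (r u C s w) ≡ alt (u C w)) → TopBitLaw N → ∀ w u → w < N →
  altBinom (double N ℕ.+ s w) (double N ℕ.+ r u) + altBinom (double N ℕ.+ s w) (r u)
    ≡ + 1 + altBinom (s w) (r u)
topBitLaw-double-digits {N} r s r-shift s-shift lucas law w u w<N = begin
  alt ((double N ℕ.+ r u) C (double N ℕ.+ s w)) + alt (r u C (double N ℕ.+ s w))
    ≡⟨ cong₂ (λ i k → alt (i C k) + alt (r u C k)) (r-shift u) (s-shift w) ⟩
  alt (r (N ℕ.+ u) C s (N ℕ.+ w)) + alt (r u C s (N ℕ.+ w))
    ≡⟨ cong₂ _+_ (lucas (N ℕ.+ u) (N ℕ.+ w)) (lucas u (N ℕ.+ w)) ⟩
  alt ((N ℕ.+ u) C (N ℕ.+ w)) + alt (u C (N ℕ.+ w))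
    ≡⟨ law w u w<N ⟩
  + 1 + alt (u C w)
    ≡⟨ cong (_+_ (+ 1)) (lucas u w) ⟨
  + 1 + alt (r u C s w)
    ∎

topBitLaw-double : ∀ {N} → TopBitLaw N → TopBitLaw (double N)
topBitLaw-double {N} law m x m<2N with halving x | halving m
... | even y | even q = topBitLaw-double-digits double double shift-even shift-even
                          alt[2nC2k]≡alt[nCk] law q y (double-cancel-< m<2N)
  where
  shift-even : ∀ u → double N ℕ.+ double u ≡ double (N ℕ.+ u)
  shift-even u = sym (double-+ N u)
... | odd y  | even q = topBitLaw-double-digits (suc ∘ double) double shift-odd shift-even
                          alt[1+2nC2k]≡alt[nCk] law q y (double-cancel-< m<2N)
  where
  shift-even : ∀ u → double N ℕ.+ double u ≡ double (N ℕ.+ u)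
  shift-even u = sym (double-+ N u)
  shift-odd : ∀ u → double N ℕ.+ suc (double u) ≡ suc (double (N ℕ.+ u))
  shift-odd u = trans (ℕP.+-suc (double N) (double u)) (cong suc (sym (double-+ N u)))
... | odd y  | odd q = topBitLaw-double-digits (suc ∘ double) (suc ∘ double) shift-odd shift-odd
                          alt[1+2nC1+2k]≡alt[nCk] law q y (double-cancel-< (ℕP.<-trans (ℕP.n<1+n _) m<2N))
  where
  shift-odd : ∀ u → double N ℕ.+ suc (double u) ≡ suc (double (N ℕ.+ u))
  shift-odd u = trans (ℕP.+-suc (double N) (double u)) (cong suc (sym (double-+ N u)))
... | even y | odd q = begin
  alt ((double N ℕ.+ double y) C (double N ℕ.+ suc (double q))) + alt (double y C (double N ℕ.+ suc (double q)))
    ≡⟨ cong₂ (λ i k → alt (i C k) + alt (double y C k)) (sym (double-+ N y))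
             (trans (ℕP.+-suc (double N) (double q)) (cong suc (sym (double-+ N q)))) ⟩
  alt (double (N ℕ.+ y) C suc (double (N ℕ.+ q))) + alt (double y C suc (double (N ℕ.+ q)))
    ≡⟨ cong₂ _+_ (alt[2nC1+2k]≡1 (N ℕ.+ y) (N ℕ.+ q)) (alt[2nC1+2k]≡1 y (N ℕ.+ q)) ⟩
  + 1 + + 1
    ≡⟨ cong (_+_ (+ 1)) (alt[2nC1+2k]≡1 y q) ⟨
  + 1 + alt (double y C suc (double q))
    ∎

topBitLaw : ∀ K → TopBitLaw (2 ^ K)
topBitLaw zero    = topBitLaw-1
topBitLaw (suc K) = subst TopBitLaw (double≡2* (2 ^ K)) (topBitLaw-double (topBitLaw K))

gOp-altBinom-topBit : ∀ K {m} → m < 2 ^ suc K →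
  ∀ j → gOp (suc K) (altBinom (2 ^ suc K ℕ.+ m)) j ≡ + 1 + altBinom m j
gOp-altBinom-topBit K {m} m<N j =
  trans (cong (_+_ (altBinom (N ℕ.+ m) (N ℕ.+ j))) (ℤP.*-identityˡ _)) (topBitLaw (suc K) m j m<N)
  where
  N : ℕ
  N = 2 ^ suc K

binaryValue : List ℕ → ℕ
binaryValue ks = sum (map (2 ^_) ks)

binaryValue-∷ʳ0 : ∀ ks → binaryValue (ks ∷ʳ 0) ≡ binaryValue ks ℕ.+ 1
binaryValue-∷ʳ0 ks = trans (cong sum (map-++ (2 ^_) ks (0 ∷ []))) (sum-++ (map (2 ^_) ks) (1 ∷ []))

binaryValue-< : ∀ {K ks} → Linked _>_ (K ∷ ks) → binaryValue ks < 2 ^ K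
binaryValue-< {K} {[]}     _           = ℕP.m^n>0 2 K
binaryValue-< {K} {k ∷ ks} (k<K ∷ lnk) = ℕP.<-≤-trans
  (subst (binaryValue (k ∷ ks) <_) (cong (2 ^ k ℕ.+_) (sym (ℕP.+-identityʳ (2 ^ k))))
         (ℕP.+-monoʳ-< (2 ^ k) (binaryValue-< lnk)))
  (ℕP.^-monoʳ-≤ 2 k<K)

lowestDigit : ∀ ks → Linked _>_ ks → Linked _>_ (ks ∷ʳ 0) ⊎ ∃ λ ks′ → ks ≡ ks′ ∷ʳ 0
lowestDigit []               _           = inj₁ [-]
lowestDigit (zero ∷ [])      _           = inj₂ ([] , refl)
lowestDigit (suc K ∷ [])     _           = inj₁ (s≤s z≤n ∷ [-])
lowestDigit (zero ∷ k ∷ ks)  (() ∷ _)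
lowestDigit (suc K ∷ k ∷ ks) (k<K ∷ lnk) with lowestDigit (k ∷ ks) lnk
... | inj₁ lnk′         = inj₁ (k<K ∷ lnk′)
... | inj₂ (ks′ , eq)   = inj₂ (suc K ∷ ks′ , cong (suc K ∷_) eq)

2∣binaryValue : ∀ ks → Linked _>_ (ks ∷ʳ 0) → 2 ∣ binaryValue ks
2∣binaryValue []             _   = m∣m*n 0
2∣binaryValue (zero ∷ [])    (() ∷ _)
2∣binaryValue (zero ∷ _ ∷ _) (() ∷ _)
2∣binaryValue (suc K ∷ ks)   lnk = ∣m∣n⇒∣m+n (m∣m*n (2 ^ K)) (2∣binaryValue ks (tail lnk))

-- Linked _>_ (ks ∷ʳ 0) says that ks is strictly decreasing and avoids the digit 0.
gsOp-altBinom : ∀ ks {m₀} → Linked _>_ (ks ∷ʳ 0) → m₀ ≤ 1 →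
  gsOp ks (altBinom (binaryValue ks ℕ.+ m₀)) ≈ᶜ altBinom m₀
gsOp-altBinom [] _ _ = + 0 , λ j → sym (ℤP.+-identityˡ _)
gsOp-altBinom (zero ∷ [])    (() ∷ _)
gsOp-altBinom (zero ∷ _ ∷ _) (() ∷ _)
gsOp-altBinom (suc K ∷ ks) {m₀} lnk m₀≤1 =
  ≗-≈ᶜ-trans (λ j → sym (gsOp-gOp-comm ks (suc K) _ j))
             (≈ᶜ-trans (gsOp-resp-≈ᶜ ks topDigit) (gsOp-altBinom ks (tail lnk) m₀≤1))
  where
  N : ℕ
  N = 2 ^ suc K
  m′ : ℕ
  m′ = binaryValue ks ℕ.+ m₀
  m′<N : m′ < N
  m′<N = ℕP.≤-<-trans (ℕP.+-monoʳ-≤ (binaryValue ks) m₀≤1)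
                      (subst (_< N) (binaryValue-∷ʳ0 ks) (binaryValue-< lnk))
  topDigit : gOp (suc K) (altBinom (binaryValue (suc K ∷ ks) ℕ.+ m₀)) ≈ᶜ altBinom m′
  topDigit = + 1 , λ j → trans (cong (λ i → gOp (suc K) (altBinom i) j) (ℕP.+-assoc N (binaryValue ks) m₀))
                               (gOp-altBinom-topBit K m′<N j)

gsOp-gOp-zero-altBinom : ∀ ks {m₀} → Linked _>_ (ks ∷ʳ 0) → m₀ ≤ 1 →
  ∀ j → gsOp ks (gOp 0 (altBinom (binaryValue ks ℕ.+ m₀))) j ≡ gOp 0 (altBinom m₀) j
gsOp-gOp-zero-altBinom ks lnk m₀≤1 j =
  trans (gsOp-gOp-comm ks 0 _ j) (gOp-zero-≈ᶜ (gsOp-altBinom ks lnk m₀≤1) j)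

gOp-zero-altBinom-1 : ∀ j → gOp 0 (altBinom 1) j ≡ - + 2 * alt j
gOp-zero-altBinom-1 j =
  trans (cong₂ (λ u v → alt u + - + 1 * alt v) (nC1≡n (suc j)) (nC1≡n j)) (double-neg (alt j))
  where
  double-neg : ∀ x → - + 1 * x + - + 1 * x ≡ - + 2 * x
  double-neg = solve-∀

binaryValue-∷ʳ0-odd : ∀ ks → Linked _>_ (ks ∷ʳ 0) → ¬ (2 ∣ binaryValue (ks ∷ʳ 0))
binaryValue-∷ʳ0-odd ks lnk 2∣v
  with s≤s () ← ∣⇒≤ (∣m+n∣m⇒∣n (subst (2 ∣_) (binaryValue-∷ʳ0 ks) 2∣v)
                                (2∣binaryValue ks lnk))

isCharPoly-powerOfTwo : ∀ k → IsCharPoly (g (suc k)) (a (2 ^ suc k))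
isCharPoly-powerOfTwo k = g-monic (suc k) , λ n _ → begin
  recSum (g (suc k)) (a N) n                     ≡⟨ recSum-g (suc k) (altBinom N) n ⟩
  binomialTransform (gOp (suc k) (altBinom N)) n ≡⟨ binomialTransform-cong vanish n ⟩
  binomialTransform (λ _ → + 0) n                ≡⟨ binomialTransform-zero n ⟩
  + 0                                            ∎
  where
  N : ℕ
  N = 2 ^ suc k
  vanish : ∀ j → gOp (suc k) (altBinom N) j ≡ + 0
  vanish j = trans (cong (λ i → gOp (suc k) (altBinom i) j) (sym (ℕP.+-identityʳ N)))
                   (gOp-altBinom-topBit k (ℕP.m^n>0 2 (suc k)) j)

isCharPoly-even : ∀ ks → Linked _>_ (ks ∷ʳ 0) → IsCharPoly (prodG ks *ₚ g 0) (a (binaryValue ks))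
isCharPoly-even ks lnk = *ₚ-monic (prodG-monic ks) (g-monic 0) , λ n _ → begin
  recSum (prodG ks *ₚ g 0) (a m) n                   ≡⟨ recSum-*ₚ (prodG ks) (g 0) (a m) n ⟩
  recSum (prodG ks) (recSum (g 0) (a m)) n           ≡⟨ recSum-cong (prodG ks) (recSum-g 0 (altBinom m)) n ⟩
  recSum (prodG ks) (binomialTransform (gOp 0 (altBinom m))) n
                                                     ≡⟨ recSum-prodG ks (gOp 0 (altBinom m)) n ⟩
  binomialTransform (gsOp ks (gOp 0 (altBinom m))) n ≡⟨ binomialTransform-cong strip n ⟩
  binomialTransform (gOp 0 (altBinom 0)) n           ≡⟨ binomialTransform-zero n ⟩
  + 0                                                ∎
  where
  m : ℕ
  m = binaryValue ks
  strip : ∀ j → gsOp ks (gOp 0 (altBinom m)) j ≡ gOp 0 (altBinom 0) j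
  strip j = trans (cong (λ i → gsOp ks (gOp 0 (altBinom i)) j) (sym (ℕP.+-identityʳ m)))
                  (gsOp-gOp-zero-altBinom ks lnk z≤n j)

isCharPoly-odd : ∀ ks → Linked _>_ (ks ∷ʳ 0) → IsCharPoly (prodG (ks ∷ʳ 0)) (a (binaryValue (ks ∷ʳ 0)))
isCharPoly-odd ks lnk = prodG-monic (ks ∷ʳ 0) , λ { (suc n) _ → begin
  recSum (prodG (ks ∷ʳ 0)) (a m) (suc n)              ≡⟨ recSum-prodG (ks ∷ʳ 0) (altBinom m) (suc n) ⟩
  binomialTransform (gsOp (ks ∷ʳ 0) (altBinom m)) (suc n)
                                                      ≡⟨ cong (λ h → binomialTransform h (suc n))
                                                              (foldr-∷ʳ gOp (altBinom m) 0 ks) ⟩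
  binomialTransform (gsOp ks (gOp 0 (altBinom m))) (suc n)
                                                      ≡⟨ binomialTransform-cong strip (suc n) ⟩
  binomialTransform (λ j → - + 2 * alt j) (suc n)     ≡⟨ *-distribˡ-binomialTransform (- + 2) alt (suc n) ⟩
  - + 2 * binomialTransform alt (suc n)               ≡⟨ cong (_*_ (- + 2)) (binomialTransform-alt n) ⟩
  + 0                                                 ∎ }
  where
  m : ℕ
  m = binaryValue (ks ∷ʳ 0)
  strip : ∀ j → gsOp ks (gOp 0 (altBinom m)) j ≡ - + 2 * alt j
  strip j = begin
    gsOp ks (gOp 0 (altBinom m)) j                     ≡⟨ cong (λ i → gsOp ks (gOp 0 (altBinom i)) j)
                                                               (binaryValue-∷ʳ0 ks) ⟩
    gsOp ks (gOp 0 (altBinom (binaryValue ks ℕ.+ 1))) j ≡⟨ gsOp-gOp-zero-altBinom ks lnk ℕP.≤-refl j ⟩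
    gOp 0 (altBinom 1) j                               ≡⟨ gOp-zero-altBinom-1 j ⟩
    - + 2 * alt j                                      ∎

proposition4p2 : (m : ℕ) → 2 ≤ m → (ks : List ℕ) → Linked _>_ ks → sum (map (2 ^_) ks) ≡ m →
    ((k : ℕ) → m ≡ 2 ^ k → IsCharPoly (g k) (a m))
    × (2 ∣ m → ¬ (∃ λ k → m ≡ 2 ^ k) → IsCharPoly (prodG ks *ₚ g 0) (a m))
    × (¬ (2 ∣ m) → IsCharPoly (prodG ks) (a m))
proposition4p2 m 2≤m ks lnk refl = powerOfTwo , evenCase , oddCase
  where
  powerOfTwo : (k : ℕ) → m ≡ 2 ^ k → IsCharPoly (g k) (a m)
  powerOfTwo zero    m≡1 with s≤s () ← subst (2 ≤_) m≡1 2≤m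
  powerOfTwo (suc k) m≡N = subst (IsCharPoly (g (suc k)) ∘ a) (sym m≡N) (isCharPoly-powerOfTwo k)

  evenCase : 2 ∣ m → ¬ (∃ λ k → m ≡ 2 ^ k) → IsCharPoly (prodG ks *ₚ g 0) (a m)
  evenCase 2∣m _ with lowestDigit ks lnk
  ... | inj₁ lnk₀         = isCharPoly-even ks lnk₀
  ... | inj₂ (ks′ , refl) = ⊥-elim (binaryValue-∷ʳ0-odd ks′ lnk 2∣m)

  oddCase : ¬ (2 ∣ m) → IsCharPoly (prodG ks) (a m)
  oddCase 2∤m with lowestDigit ks lnk
  ... | inj₁ lnk₀         = ⊥-elim (2∤m (2∣binaryValue ks lnk₀))
  ... | inj₂ (ks′ , refl) = isCharPoly-odd ks′ lnk
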